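{- Let $p$ be a prime, $n$ a non-negative integer, and $a_1,a_2$ integers not divisible by $p$. If $r_n(a_1,p)=r_n(a_2,p)$, then $a_1\equiv a_2 \pmod p$ or $a_1a_2\equiv 1+6n^2 \pmod p$.
   Context: For real $x$, the sawtooth function is $((x)) = \{x\}-\tfrac12$ if $x\notin\mathbb Z$ and $((x))=0$ if $x\in\mathbb Z$, where $\{x\}=x-\lfloor x\rfloor$. For a non-negative integer $n$, a positive integer $b$ and an integer $a$ relatively prime to $b$, the Dedekind–Rademacher sum is \[ r_n(a,b)=\sum_{k=0}^{b-1}\left(\left(\frac{ka+n}{b}\right)\right)\left(\left(\frac{k}{b}\right)\right). \] -}

module Defs where

open import Data.Nat as ℕ using (ℕ; suc)
open import Data.Integer as ℤ using (ℤ; +_)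
open import Data.Rational as ℚ using (ℚ; floor; _/_; _-_; _+_; _*_; ½; 0ℚ)
open import Data.List using (List; map; upTo; foldr)
open import Relation.Nullary using (yes; no)

⌊_⌋ℚ : ℚ → ℚ
⌊ x ⌋ℚ = floor x / 1

frac : ℚ → ℚ
frac x = x - ⌊ x ⌋ℚ

saw : ℚ → ℚ
saw x with x ℚ.≟ ⌊ x ⌋ℚ
... | yes _ = 0ℚ
... | no _  = frac x - ½

sumTo : ℕ → (ℕ → ℚ) → ℚ
sumTo b f = foldr _+_ 0ℚ (map f (upTo b))

r : ℕ → ℤ → (b : ℕ) → .{{ℕ.NonZero b}} → ℚ
r n a b = sumTo b (λ k → saw (((+ k) ℤ.* a ℤ.+ (+ n)) / b) * saw ((+ k) / b))

module Submission where

-- Write m_k = (ka + n) mod p and g(j) = 2p·((j/p)), i.e. g(0) = 0 and g(j) = 2j - p for 0 < j < p.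
-- Then (2p)²·r_n(a,p) = G(a) := Σ_{k<p} g(m_k)·g(k) is an integer, so equal sums give G(a₁) = G(a₂).
-- The heart of the argument is the congruence
--     3a·G(a) ≡ p(a² + 1 + 6n²)   (mod p²).
-- Term by term, completing the square in ka ≡ m_k - n approximates 3a·g(m_k)·g(k) modulo p² by
-- residuePart(m_k) + indexPart(k): a polynomial in m_k plus a polynomial in k (with indicator terms
-- at 0).  Since k ↦ m_k permutes {0,…,p-1} when p ∤ a, the residue parts may be reindexed, and the
-- power sums Σk, Σk² have closed forms whose value modulo p² is p(a² + 1 + 6n²).  Eliminating G
-- between the congruences for a₁ and a₂ gives p² ∣ p(a₁ - a₂)(a₁a₂ - 1 - 6n²); Euclid's lemma ends.

open import Agda.Builtin.FromNat using (Number; fromNat)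
open import Data.Empty using (⊥-elim)
open import Data.Fin as Fin using (Fin; toℕ; fromℕ<)
open import Data.Fin.Permutation using (Permutation′; permutation)
import Data.Fin.Properties as FinP
open import Data.Integer as ℤ using (ℤ; +_; _+_; _*_; _-_; -_; 0ℤ)
open import Data.Integer.Divisibility using (_∣_)
open import Data.Integer.Divisibility.Signed as Signed using (divides) renaming (_∣_ to _∣ˢ_)
import Data.Integer.DivMod as ℤD
import Data.Integer.Literals as ℤLiterals
import Data.Integer.Properties as ℤP
open import Data.Integer.Tactic.RingSolver using (solve-∀)
open import Data.List using (applyUpTo; foldr)
import Data.List.Properties as ListP
open import Data.Nat as ℕ using (ℕ; zero; suc; _<_)
import Data.Nat.Divisibility as ℕD
import Data.Nat.DivMod as ℕDM
import Data.Nat.Literals as ℕLiterals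
open import Data.Nat.Primality using (Prime; prime⇒nonZero; euclidsLemma)
import Data.Nat.Properties as ℕP
open import Data.Product using (∃; _,_; proj₁; proj₂)
open import Data.Rational as ℚ using (ℚ)
import Data.Rational.Properties as ℚP
open import Data.Rational.Unnormalised as ℚᵘ using (mkℚᵘ; *≡*) renaming (_≃_ to _≃ᵘ_; _/_ to _/ᵘ_)
import Data.Rational.Unnormalised.Properties as ℚᵘP
open import Data.Sum using (_⊎_; inj₁; inj₂)
open import Data.Unit using (tt)
open import Function using (_∘_; Injective)
open import Relation.Binary.Definitions using (tri<; tri≈; tri>)
open import Relation.Binary.PropositionalEquality
open import Relation.Nullary using (¬_; yes; no; contradiction)

open import Algebra.Properties.AbelianGroup ℤP.+-0-abelianGroup using (identityˡ-unique)
open import Algebra.Properties.Semiring.Sum ℤP.+-*-semiring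
  using (sum; sum-cong-≗; sum-permute; ∑-distrib-+; *-distribˡ-sum)

open import Defs using (⌊_⌋ℚ; frac; saw; r)

instance
  ℕ-number : Number ℕ
  ℕ-number = ℕLiterals.number
  ℤ-number : Number ℤ
  ℤ-number = ℤLiterals.number

infix 4 _≡_mod_
_≡_mod_ : ℤ → ℤ → ℤ → Set
_≡_mod_ x y m = m ∣ˢ (x - y)

≡⇒≡mod : ∀ {x y} m → x ≡ y → x ≡ y mod m
≡⇒≡mod {x} m refl = divides 0ℤ (trans (ℤP.+-inverseʳ x) (sym (ℤP.*-zeroˡ m)))

≡mod-trans : ∀ {x y z m} → x ≡ y mod m → y ≡ z mod m → x ≡ z mod m
≡mod-trans {x} {y} {z} x≡y y≡z =
  subst (_ ∣ˢ_) (split x y z) (Signed.∣m∣n⇒∣m+n x≡y y≡z)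
  where
  split : ∀ x y z → (x - y) + (y - z) ≡ x - z
  split = solve-∀

≡mod-+ : ∀ {x y u v m} → x ≡ y mod m → u ≡ v mod m → x + u ≡ y + v mod m
≡mod-+ {x} {y} {u} {v} x≡y u≡v =
  subst (_ ∣ˢ_) (regroup x y u v) (Signed.∣m∣n⇒∣m+n x≡y u≡v)
  where
  regroup : ∀ x y u v → (x - y) + (u - v) ≡ (x + u) - (y + v)
  regroup = solve-∀

sum-≡mod : ∀ {n m} (f h : Fin n → ℤ) → (∀ i → f i ≡ h i mod m) → sum f ≡ sum h mod m
sum-≡mod {zero}  {m} f h _   = ≡⇒≡mod {0ℤ} m refl
sum-≡mod {suc n}     f h f≡h =
  ≡mod-+ {f Fin.zero} {h Fin.zero} (f≡h Fin.zero)
    (sum-≡mod (f ∘ Fin.suc) (h ∘ Fin.suc) (f≡h ∘ Fin.suc))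

prime-∣-* : ∀ {p} → Prime p → ∀ x y → + p ∣ x * y → + p ∣ x ⊎ + p ∣ y
prime-∣-* pr x y p∣xy = euclidsLemma ℤ.∣ x ∣ ℤ.∣ y ∣ pr (subst (_ ℕD.∣_) (ℤP.abs-* x y) p∣xy)

∣-difference⇒≡ : ∀ {p k k'} → k < p → k' < p → + p ∣ (+ k - + k') → k ≡ k'
∣-difference⇒≡ {p} {k} {k'} k<p k'<p p∣k-k' with ℤ.∣ + k - + k' ∣ in eq
... | zero  = ℤP.+-injective (ℤP.i-j≡0⇒i≡j (+ k) (+ k') (ℤP.∣i∣≡0⇒i≡0 eq))
... | suc d = contradiction (ℕD.∣⇒≤ p∣k-k') (ℕP.<⇒≱ (subst (_< p) eq ∣k-k'∣<p))
  where
  ∣k-k'∣<p : ℤ.∣ + k - + k' ∣ < p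
  ∣k-k'∣<p = ℕP.≤-<-trans (subst (ℕ._≤ k ℕ.⊔ k') (cong ℤ.∣_∣ (sym (ℤP.m-n≡m⊖n k k'))) (ℤP.∣m⊝n∣≤m⊔n k k'))
                          (ℕP.⊔-lub k<p k'<p)

-- Eliminating G between the congruences for a₁ and a₂: a₁·X₂ - a₂·X₁ = P(a₁ - a₂)(a₁a₂ - c),
-- where Xᵢ = 3aᵢG - P(aᵢ² + c), so P² ∣ P(a₁ - a₂)(a₁a₂ - c).
eliminate : ∀ {P G c a₁ a₂} .{{_ : ℤ.NonZero P}} →
  3 * a₁ * G ≡ P * (a₁ * a₁ + c) mod (P * P) → 3 * a₂ * G ≡ P * (a₂ * a₂ + c) mod (P * P) →
  P ∣ˢ (a₁ - a₂) * (a₁ * a₂ - c)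
eliminate {P} {G} {c} {a₁} {a₂} k₁ k₂ = Signed.*-cancelˡ-∣ P
  (subst (P * P ∣ˢ_) (combination P G c a₁ a₂) (Signed.∣m∣n⇒∣m-n (Signed.∣n⇒∣m*n a₁ k₂) (Signed.∣n⇒∣m*n a₂ k₁)))
  where
  combination : ∀ P G c a₁ a₂ →
    a₁ * (3 * a₂ * G - P * (a₂ * a₂ + c)) - a₂ * (3 * a₁ * G - P * (a₁ * a₁ + c)) ≡ P * ((a₁ - a₂) * (a₁ * a₂ - c))
  combination = solve-∀

injective⇒onto : ∀ {n} {f : Fin n → Fin n} → Injective _≡_ _≡_ f → ∀ y → ∃ λ x → f x ≡ y
injective⇒onto {suc n} {f} f-inj y with FinP.any? (λ x → f x FinP.≟ y)
... | yes hit = hit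
... | no miss = contradiction (FinP.injective⇒≤ skip-injective) ℕP.1+n≰n
  where
  y≢f : ∀ x → y ≢ f x
  y≢f x eq = miss (x , sym eq)
  skip : Fin (suc n) → Fin n
  skip x = Fin.punchOut (y≢f x)
  skip-injective : Injective _≡_ _≡_ skip
  skip-injective eq = f-inj (FinP.punchOut-injective (y≢f _) (y≢f _) eq)

sum-reindex : ∀ {n} {f : Fin n → Fin n} → Injective _≡_ _≡_ f → (h : Fin n → ℤ) → sum (h ∘ f) ≡ sum h
sum-reindex {n} {f} f-inj h = sym (sum-permute h π)
  where
  f⁻¹ : Fin n → Fin n
  f⁻¹ y = proj₁ (injective⇒onto f-inj y)
  π : Permutation′ n
  π = permutation f f⁻¹ (λ y → proj₂ (injective⇒onto f-inj y))
                        (λ x → f-inj (proj₂ (injective⇒onto f-inj (f x))))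

sumBelow : ℕ → (ℕ → ℤ) → ℤ
sumBelow N f = sum {N} (f ∘ toℕ)

sumBelow-suc : ∀ N (f : ℕ → ℤ) → sumBelow (suc N) f ≡ sumBelow N f + f N
sumBelow-suc zero    f = ℤP.+-comm (f 0) 0ℤ
sumBelow-suc (suc N) f = begin
  f 0 + sumBelow (suc N) (f ∘ suc)          ≡⟨ cong (_+_ (f 0)) (sumBelow-suc N (f ∘ suc)) ⟩
  f 0 + (sumBelow N (f ∘ suc) + f (suc N))  ≡⟨ ℤP.+-assoc (f 0) _ _ ⟨
  sumBelow (suc N) f + f (suc N)            ∎
  where open ≡-Reasoning

sumBelow-reindex : ∀ N (ρ : ℕ → ℕ) → (ρ< : ∀ k → k < N → ρ k < N) →
  (∀ {k k'} → k < N → k' < N → ρ k ≡ ρ k' → k ≡ k') →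
  ∀ h → sumBelow N (h ∘ ρ) ≡ sumBelow N h
sumBelow-reindex N ρ ρ< ρ-inj h = begin
  sumBelow N (h ∘ ρ)       ≡⟨ sum-cong-≗ (λ i → cong h (toℕ-ρ̂ i)) ⟨
  sum {N} (h ∘ toℕ ∘ ρ̂)  ≡⟨ sum-reindex ρ̂-injective (h ∘ toℕ) ⟩
  sumBelow N h             ∎
  where
  open ≡-Reasoning
  ρ̂ : Fin N → Fin N
  ρ̂ i = fromℕ< (ρ< (toℕ i) (FinP.toℕ<n i))
  toℕ-ρ̂ : ∀ i → toℕ (ρ̂ i) ≡ ρ (toℕ i)
  toℕ-ρ̂ i = FinP.toℕ-fromℕ< _
  ρ̂-injective : Injective _≡_ _≡_ ρ̂
  ρ̂-injective {i} {j} eq = FinP.toℕ-injective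
    (ρ-inj (FinP.toℕ<n i) (FinP.toℕ<n j) (trans (sym (toℕ-ρ̂ i)) (trans (cong toℕ eq) (toℕ-ρ̂ j))))

δ : ℕ → ℤ
δ zero    = 1
δ (suc _) = 0

-- Closed form of Σ_{k<N} of a quadratic polynomial plus a multiple of the indicator of zero,
-- written so that no division is needed: Σ 6k² = N(N-1)(2N-1) and Σ 2k = N(N-1).
quadratic-sum : ∀ α β γ ε N → let P = + suc N in
  sumBelow (suc N) (λ k → α * (6 * (+ k * + k)) + β * (2 * + k) + γ + ε * δ k)
    ≡ α * (P * (P - 1) * (2 * P - 1)) + β * (P * (P - 1)) + γ * P + ε
quadratic-sum α β γ ε zero    = base α β γ ε
  where
  base : ∀ α β γ ε → α * (6 * (0 * 0)) + β * (2 * 0) + γ + ε * 1 + 0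
                   ≡ α * (1 * (1 - 1) * (2 * 1 - 1)) + β * (1 * (1 - 1)) + γ * 1 + ε
  base = solve-∀
quadratic-sum α β γ ε (suc N) = begin
  sumBelow (suc (suc N)) Q                                     ≡⟨ sumBelow-suc (suc N) Q ⟩
  sumBelow (suc N) Q + Q (suc N)                               ≡⟨ cong (_+ Q (suc N)) (quadratic-sum α β γ ε N) ⟩
  α * (P * (P - 1) * (2 * P - 1)) + β * (P * (P - 1)) + γ * P + ε + Q (suc N)
                                                               ≡⟨ step α β γ ε P ⟩
  α * ((1 + P) * (1 + P - 1) * (2 * (1 + P) - 1)) + β * ((1 + P) * (1 + P - 1)) + γ * (1 + P) + ε ∎
  where
  open ≡-Reasoning
  P = + suc N
  Q : ℕ → ℤ
  Q k = α * (6 * (+ k * + k)) + β * (2 * + k) + γ + ε * δ k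
  step : ∀ α β γ ε P →
    α * (P * (P - 1) * (2 * P - 1)) + β * (P * (P - 1)) + γ * P + ε + (α * (6 * (P * P)) + β * (2 * P) + γ + ε * 0)
      ≡ α * ((1 + P) * (1 + P - 1) * (2 * (1 + P) - 1)) + β * ((1 + P) * (1 + P - 1)) + γ * (1 + P) + ε
  step = solve-∀

/ℕ-unique : ∀ z d q → q * + suc d ℤ.≤ z → z ℤ.< (1 + q) * + suc d → z ℤ./ℕ suc d ≡ q
/ℕ-unique z d q lower upper with ℤP.<-cmp (z ℤ./ℕ suc d) q
... | tri≈ _ same _ = same
... | tri< less _ _ = contradiction (ℤD.n<s[n/ℕd]*d z (suc d))
  (ℤP.≤⇒≯ (ℤP.≤-trans (ℤP.*-monoʳ-≤-nonNeg (+ suc d) (ℤP.i<j⇒suc[i]≤j less)) lower))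
... | tri> _ _ more = contradiction upper
  (ℤP.≤⇒≯ (ℤP.≤-trans (ℤP.*-monoʳ-≤-nonNeg (+ suc d) (ℤP.i<j⇒suc[i]≤j more)) (ℤD.[n/ℕd]*d≤n z (suc d))))

floor-cong : ∀ {x y} → x ≃ᵘ y → ℚᵘ.floor x ≡ ℚᵘ.floor y
floor-cong {mkℚᵘ z d} {mkℚᵘ w e} (*≡* cross) = begin
  z ℤ./ + suc d   ≡⟨ ℤD.div-pos-is-/ℕ z (suc d) ⟩
  z ℤ./ℕ suc d    ≡⟨ /ℕ-unique z d q lower upper ⟩
  q               ≡⟨ ℤD.div-pos-is-/ℕ w (suc e) ⟨
  w ℤ./ + suc e   ∎
  where
  open ≡-Reasoning
  D E : ℤ
  D = + suc d
  E = + suc e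
  q = w ℤ./ℕ suc e
  swap : ∀ u v t → u * v * t ≡ u * t * v
  swap = solve-∀
  -- From q·E ≤ w < (q+1)·E multiply by D and use z·E = w·D, then cancel E.
  lower : q * D ℤ.≤ z
  lower = ℤP.*-cancelʳ-≤-pos (q * D) z E
    (subst₂ ℤ._≤_ (swap q E D) (sym cross) (ℤP.*-monoʳ-≤-nonNeg D (ℤD.[n/ℕd]*d≤n w (suc e))))
  upper : z ℤ.< (1 + q) * D
  upper = ℤP.*-cancelʳ-<-nonNeg E
    (subst₂ ℤ._<_ (sym cross) (swap (1 + q) E D) (ℤP.*-monoʳ-<-pos D (ℤD.n<s[n/ℕd]*d w (suc e))))

toℚᵘ-/ : ∀ z d → ℚ.toℚᵘ (z ℚ./ suc d) ≃ᵘ mkℚᵘ z d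
toℚᵘ-/ z d = ℚP.toℚᵘ-fromℚᵘ (mkℚᵘ z d)

floor-toℚᵘ : ∀ x → ℚ.floor x ≡ ℚᵘ.floor (ℚ.toℚᵘ x)
floor-toℚᵘ (ℚ.mkℚ _ _ _) = refl

floor-/ : ∀ z d → ℚ.floor (z ℚ./ suc d) ≡ z ℤ./ℕ suc d
floor-/ z d = trans (floor-toℚᵘ (z ℚ./ suc d)) (trans (floor-cong (toℚᵘ-/ z d)) (ℤD.div-pos-is-/ℕ z (suc d)))

common-denominator : ∀ u v d → (u /ᵘ suc d) ℚᵘ.+ (v /ᵘ suc d) ≃ᵘ (u + v) /ᵘ suc d
common-denominator u v d =
  *≡* (trans (collect u v (+ suc d)) (cong ((u + v) *_) (sym (ℤP.pos-* (suc d) (suc d)))))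
  where
  collect : ∀ u v D → (u * D + v * D) * D ≡ (u + v) * (D * D)
  collect = solve-∀

numerator-injective : ∀ {u v} d → u /ᵘ suc d ≃ᵘ v /ᵘ suc d → u ≡ v
numerator-injective {u} {v} d (*≡* cross) = ℤP.*-cancelʳ-≡ u v (+ suc d) cross

fraction-sum : ∀ N (f : ℕ → ℚ) (h : ℕ → ℤ) d → (∀ k → k < N → ℚ.toℚᵘ (f k) ≃ᵘ h k /ᵘ suc d) →
  ℚ.toℚᵘ (foldr ℚ._+_ ℚ.0ℚ (applyUpTo f N)) ≃ᵘ sumBelow N h /ᵘ suc d
fraction-sum zero    f h d _     = *≡* refl
fraction-sum (suc N) f h d terms = begin
  ℚ.toℚᵘ (f 0 ℚ.+ rest)                                  ≈⟨ ℚP.toℚᵘ-homo-+ (f 0) rest ⟩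
  ℚ.toℚᵘ (f 0) ℚᵘ.+ ℚ.toℚᵘ rest                          ≈⟨ ℚᵘP.+-cong (terms 0 ℕ.z<s)
                                                              (fraction-sum N (f ∘ suc) (h ∘ suc) d (λ k k<N → terms (suc k) (ℕ.s<s k<N))) ⟩
  (h 0 /ᵘ suc d) ℚᵘ.+ (sumBelow N (h ∘ suc) /ᵘ suc d)    ≈⟨ common-denominator (h 0) (sumBelow N (h ∘ suc)) d ⟩
  sumBelow (suc N) h /ᵘ suc d                            ∎
  where
  open ℚᵘP.≃-Reasoning
  rest = foldr ℚ._+_ ℚ.0ℚ (applyUpTo (f ∘ suc) N)

-- g P j = 2p·((j/p)) for a residue 0 ≤ j < p, where P = + p.
g : ℤ → ℕ → ℤ
g P zero    = 0
g P (suc j) = 2 * + suc j - P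

-- The sawtooth function at z/p, p = suc p′: with m = z mod p and q = z div p,
-- ((z/p)) = (2m - p)/(2p) = g(m)/(2p) if m ≠ 0 and ((z/p)) = 0 = g(0)/(2p) otherwise.
module Sawtooth (p′ : ℕ) (z : ℤ) where

  p : ℕ
  p = suc p′

  P : ℤ
  P = + p

  x : ℚ
  x = z ℚ./ p

  m : ℕ
  m = z ℤ.%ℕ p

  q : ℤ
  q = z ℤ./ℕ p

  division : z ≡ + m + q * P
  division = ℤD.a≡a%ℕn+[a/ℕn]*n z p

  toℚᵘ-⌊x⌋ : ℚ.toℚᵘ ⌊ x ⌋ℚ ≃ᵘ mkℚᵘ q 0
  toℚᵘ-⌊x⌋ = subst (λ t → ℚ.toℚᵘ ⌊ x ⌋ℚ ≃ᵘ mkℚᵘ t 0) (floor-/ z p′) (toℚᵘ-/ (ℚ.floor x) 0)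

  integral⇒m≡0 : x ≡ ⌊ x ⌋ℚ → m ≡ 0
  integral⇒m≡0 x≡⌊x⌋
    with ℚᵘP.≃-trans (ℚᵘP.≃-sym (toℚᵘ-/ z p′)) (ℚᵘP.≃-trans (ℚP.toℚᵘ-cong x≡⌊x⌋) toℚᵘ-⌊x⌋)
  ... | *≡* z*1≡q*P =
    ℤP.+-injective (identityˡ-unique (+ m) (q * P) (trans (sym division) (trans (sym (ℤP.*-identityʳ z)) z*1≡q*P)))

  m≡0⇒integral : m ≡ 0 → x ≡ ⌊ x ⌋ℚ
  m≡0⇒integral m≡0 = ℚP.toℚᵘ-injective
    (ℚᵘP.≃-trans (toℚᵘ-/ z p′) (ℚᵘP.≃-trans (*≡* z*1≡q*P) (ℚᵘP.≃-sym toℚᵘ-⌊x⌋)))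
    where
    z*1≡q*P : z * 1 ≡ q * P
    z*1≡q*P = trans (ℤP.*-identityʳ z)
      (trans division (trans (cong (λ t → + t + q * P) m≡0) (ℤP.+-identityˡ (q * P))))

  -- Off the integers, {z/p} - ½ = (z - qP)/p - ½ = (2m - p)/(2p).
  fractional : ∀ j → m ≡ suc j → ℚ.toℚᵘ (frac x ℚ.- ℚ.½) ≃ᵘ g P (suc j) /ᵘ (2 ℕ.* p)
  fractional j m≡1+j = begin
    ℚ.toℚᵘ ((x ℚ.- ⌊ x ⌋ℚ) ℚ.- ℚ.½)
      ≈⟨ ℚP.toℚᵘ-homo-+ (x ℚ.- ⌊ x ⌋ℚ) (ℚ.- ℚ.½) ⟩
    ℚ.toℚᵘ (x ℚ.- ⌊ x ⌋ℚ) ℚᵘ.+ ℚ.toℚᵘ (ℚ.- ℚ.½)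
      ≈⟨ ℚᵘP.+-cong (ℚᵘP.≃-trans (ℚP.toℚᵘ-homo-+ x (ℚ.- ⌊ x ⌋ℚ))
                      (ℚᵘP.+-cong (toℚᵘ-/ z p′) (ℚᵘP.≃-trans (ℚP.toℚᵘ-homo‿- ⌊ x ⌋ℚ) (ℚᵘP.-‿cong toℚᵘ-⌊x⌋))))
                    (ℚP.toℚᵘ-homo‿- ℚ.½) ⟩
    (mkℚᵘ z p′ ℚᵘ.+ ℚᵘ.- mkℚᵘ q 0) ℚᵘ.+ ℚᵘ.- ℚ.toℚᵘ ℚ.½
      ≈⟨ *≡* (cross-multiplied z (+ suc j) q P (trans division (cong (λ t → + t + q * P) m≡1+j))) ⟩
    g P (suc j) /ᵘ (2 ℕ.* p) ∎
    where
    open ℚᵘP.≃-Reasoning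
    cross-multiplied : ∀ z M q P → z ≡ M + q * P →
      ((z * 1 + - q * P) * 2 + - 1 * (P * 1)) * (2 * P) ≡ (2 * M - P) * (P * 1 * 2)
    cross-multiplied _ M q P refl = identity M q P
      where
      identity : ∀ M q P → (((M + q * P) * 1 + - q * P) * 2 + - 1 * (P * 1)) * (2 * P) ≡ (2 * M - P) * (P * 1 * 2)
      identity = solve-∀

  sawtooth : ℚ.toℚᵘ (saw x) ≃ᵘ g P m /ᵘ (2 ℕ.* p)
  sawtooth with x ℚ.≟ ⌊ x ⌋ℚ | m in m≡
  ... | yes _          | zero  = *≡* refl
  ... | yes x≡⌊x⌋      | suc j = contradiction (trans (sym m≡) (integral⇒m≡0 x≡⌊x⌋)) λ ()
  ... | no  x≢⌊x⌋      | zero  = contradiction (m≡0⇒integral m≡) x≢⌊x⌋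
  ... | no  _          | suc j = fractional j m≡

-- The quadratic approximation of 3a·g(m)·g(x) modulo P², split into a part depending only
-- on the residue m and a part depending only on the index x (d = δ m, e = δ x).
residuePoly : (a n P M d : ℤ) → ℤ
residuePoly a n P M d = 6 * (M * M) - (12 * n + 6 * a * P) * M - 6 * P * n * d

indexPoly : (a n P X e : ℤ) → ℤ
indexPoly a n P X e = 6 * (a * a) * (X * X) + (12 * a * n - 6 * a * P) * X + 6 * (n * n) + 6 * a * P * n * e

residuePart : (a n P : ℤ) → ℕ → ℤ
residuePart a n P m = residuePoly a n P (+ m) (δ m)

indexPart : (a n P : ℤ) → ℕ → ℤ
indexPart a n P x = indexPoly a n P (+ x) (δ x)

-- Completing the square: with n = M + qP - Xa, 12aMX = 6M² + 6a²X² - 6(n - qP)², which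
-- produces the two polynomials above up to a multiple of P² and the terms d·M and e·X.
square-identity : ∀ a P q M X d e → let n = M + q * P - X * a in
  3 * a * ((2 * M - P + P * d) * (2 * X - P + P * e))
    - ((6 * (M * M) - (12 * n + 6 * a * P) * M - 6 * P * n * d)
       + (6 * (a * a) * (X * X) + (12 * a * n - 6 * a * P) * X + 6 * (n * n) + 6 * a * P * n * e))
    ≡ (6 * q * (d - q - a * e) + 3 * a * (1 - d) * (1 - e)) * (P * P) + 6 * P * (d * M) + 6 * (a * a) * P * (e * X)
square-identity = solve-∀

g-closed : ∀ P m → g P m ≡ 2 * + m - P + P * δ m
g-closed P zero    = at-zero P
  where
  at-zero : ∀ P → 0 ≡ 2 * 0 - P + P * 1
  at-zero = solve-∀
g-closed P (suc m) = at-suc P (+ suc m)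
  where
  at-suc : ∀ P M → 2 * M - P ≡ 2 * M - P + P * 0
  at-suc = solve-∀

δ-annihilates : ∀ m → δ m * + m ≡ 0
δ-annihilates zero    = refl
δ-annihilates (suc m) = refl

term-congruence : ∀ a n P q m x → n ≡ + m + q * P - + x * a →
  3 * a * (g P m * g P x) ≡ residuePart a n P m + indexPart a n P x mod (P * P)
term-congruence a _ P q m x refl = divides W (begin
  3 * a * (g P m * g P x) - parts
    ≡⟨ cong₂ (λ u v → 3 * a * (u * v) - parts) (g-closed P m) (g-closed P x) ⟩
  3 * a * ((2 * M - P + P * δ m) * (2 * X - P + P * δ x)) - parts
    ≡⟨ square-identity a P q M X (δ m) (δ x) ⟩
  W * (P * P) + 6 * P * (δ m * M) + 6 * (a * a) * P * (δ x * X)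
    ≡⟨ cong₂ (λ s t → W * (P * P) + 6 * P * s + 6 * (a * a) * P * t) (δ-annihilates m) (δ-annihilates x) ⟩
  W * (P * P) + 6 * P * 0 + 6 * (a * a) * P * 0
    ≡⟨ drop-zeros (W * (P * P)) (6 * P) (6 * (a * a) * P) ⟩
  W * (P * P) ∎)
  where
  open ≡-Reasoning
  M = + m
  X = + x
  n = M + q * P - X * a
  parts = residuePart a n P m + indexPart a n P x
  W = 6 * q * (δ m - q - a * δ x) + 3 * a * (1 - δ m) * (1 - δ x)
  drop-zeros : ∀ w s t → w + s * 0 + t * 0 ≡ w
  drop-zeros = solve-∀

solve-for : ∀ {x n y} → x + n ≡ y → n ≡ y - x
solve-for {x} {n} refl = cancel x n
  where
  cancel : ∀ x n → n ≡ x + n - x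
  cancel = solve-∀

module Residues (p′ : ℕ) (a : ℤ) (n : ℕ) where

  p : ℕ
  p = suc p′

  P N : ℤ
  P = + p
  N = + n

  residue : ℕ → ℕ
  residue k = (+ k * a + N) ℤ.%ℕ p

  carry : ℕ → ℤ
  carry k = (+ k * a + N) ℤ./ℕ p

  division : ∀ k → + k * a + N ≡ + residue k + carry k * P
  division k = ℤD.a≡a%ℕn+[a/ℕn]*n (+ k * a + N) p

  residue<p : ∀ k → residue k < p
  residue<p k = ℤD.n%ℕd<d (+ k * a + N) p

  residue-injective : Prime p → ¬ (P ∣ a) → ∀ {k k'} → k < p → k' < p → residue k ≡ residue k' → k ≡ k'
  residue-injective pr p∤a {k} {k'} k<p k'<p same with prime-∣-* pr (+ k - + k') a p∣[k-k']a
    where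
    difference : (+ k - + k') * a ≡ (carry k - carry k') * P
    difference = begin
      (+ k - + k') * a                                   ≡⟨ expand (+ k) (+ k') a N ⟩
      (+ k * a + N) - (+ k' * a + N)                     ≡⟨ cong₂ _-_ (division k) (division k') ⟩
      (+ residue k + carry k * P) - (+ residue k' + carry k' * P)
                                                         ≡⟨ cong (λ r → (+ residue k + carry k * P) - (+ r + carry k' * P)) (sym same) ⟩
      (+ residue k + carry k * P) - (+ residue k + carry k' * P)
                                                         ≡⟨ collect (+ residue k) (carry k) (carry k') P ⟩
      (carry k - carry k') * P                           ∎
      where
      open ≡-Reasoning
      expand : ∀ x y a n → (x - y) * a ≡ (x * a + n) - (y * a + n)
      expand = solve-∀
      collect : ∀ m q q' P → (m + q * P) - (m + q' * P) ≡ (q - q') * P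
      collect = solve-∀
    p∣[k-k']a : P ∣ (+ k - + k') * a
    p∣[k-k']a = Signed.∣⇒∣ᵤ (divides (carry k - carry k') difference)
  ... | inj₁ p∣k-k' = ∣-difference⇒≡ k<p k'<p p∣k-k'
  ... | inj₂ p∣a    = contradiction p∣a p∤a

  -- G = Σ_{k<p} g(m_k)·g(k) = (2p)²·r_n(a,p).
  G : ℤ
  G = sumBelow p (λ k → g P (residue k) * g P k)

  r-fraction : ℚ.toℚᵘ (r n a p) ≃ᵘ G /ᵘ (2 ℕ.* p ℕ.* (2 ℕ.* p))
  r-fraction = subst (λ terms → ℚ.toℚᵘ (foldr ℚ._+_ ℚ.0ℚ terms) ≃ᵘ G /ᵘ (2 ℕ.* p ℕ.* (2 ℕ.* p)))
    (sym (ListP.map-upTo term p))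
    (fraction-sum p term (λ k → g P (residue k) * g P k) _ term-value)
    where
    term : ℕ → ℚ
    term k = saw ((+ k * a + N) ℚ./ p) ℚ.* saw (+ k ℚ./ p)
    term-value : ∀ k → k < p → ℚ.toℚᵘ (term k) ≃ᵘ (g P (residue k) * g P k) /ᵘ (2 ℕ.* p ℕ.* (2 ℕ.* p))
    term-value k k<p = ℚᵘP.≃-trans (ℚP.toℚᵘ-homo-* (saw ((+ k * a + N) ℚ./ p)) (saw (+ k ℚ./ p)))
      (ℚᵘP.*-cong (Sawtooth.sawtooth p′ (+ k * a + N))
                  (subst (λ j → ℚ.toℚᵘ (saw (+ k ℚ./ p)) ≃ᵘ g P j /ᵘ (2 ℕ.* p)) (ℕDM.m<n⇒m%n≡m k<p)
                         (Sawtooth.sawtooth p′ (+ k))))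

  approximation : ℕ → ℤ
  approximation k = residuePart a N P (residue k) + indexPart a N P k

  -- Coefficients of the quadratic polynomial obtained after reindexing the residue part.
  α β γ ε : ℤ
  α = 1 + a * a
  β = 6 * a * N - 6 * N - 6 * a * P
  γ = 6 * (N * N)
  ε = 6 * P * N * (a - 1)

  approximation-sum : Prime p → ¬ (P ∣ a) →
    sumBelow p approximation ≡ α * (P * (P - 1) * (2 * P - 1)) + β * (P * (P - 1)) + γ * P + ε
  approximation-sum pr p∤a = begin
    sumBelow p approximation
      ≡⟨ ∑-distrib-+ {p} (residuePart a N P ∘ residue ∘ toℕ) (indexPart a N P ∘ toℕ) ⟩
    sumBelow p (residuePart a N P ∘ residue) + sumBelow p (indexPart a N P)
      ≡⟨ cong (_+ sumBelow p (indexPart a N P))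
              (sumBelow-reindex p residue (λ k _ → residue<p k) (residue-injective pr p∤a) (residuePart a N P)) ⟩
    sumBelow p (residuePart a N P) + sumBelow p (indexPart a N P)
      ≡⟨ ∑-distrib-+ {p} (residuePart a N P ∘ toℕ) (indexPart a N P ∘ toℕ) ⟨
    sumBelow p (λ k → residuePart a N P k + indexPart a N P k)
      ≡⟨ sum-cong-≗ {p} (λ i → combine a N P (+ toℕ i) (δ (toℕ i))) ⟩
    sumBelow p (λ k → α * (6 * (+ k * + k)) + β * (2 * + k) + γ + ε * δ k)
      ≡⟨ quadratic-sum α β γ ε p′ ⟩
    α * (P * (P - 1) * (2 * P - 1)) + β * (P * (P - 1)) + γ * P + ε ∎
    where
    open ≡-Reasoning
    combine : ∀ a N P K d →
      (6 * (K * K) - (12 * N + 6 * a * P) * K - 6 * P * N * d)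
        + (6 * (a * a) * (K * K) + (12 * a * N - 6 * a * P) * K + 6 * (N * N) + 6 * a * P * N * d)
      ≡ (1 + a * a) * (6 * (K * K)) + (6 * a * N - 6 * N - 6 * a * P) * (2 * K) + 6 * (N * N) + 6 * P * N * (a - 1) * d
    combine = solve-∀

  key-congruence : Prime p → ¬ (P ∣ a) → 3 * a * G ≡ P * (a * a + (1 + 6 * (N * N))) mod (P * P)
  key-congruence pr p∤a = ≡mod-trans {3 * a * G} termwise
    (subst (_≡ P * (a * a + (1 + 6 * (N * N))) mod (P * P)) (sym (approximation-sum pr p∤a)) closed-form)
    where
    termwise : 3 * a * G ≡ sumBelow p approximation mod (P * P)
    termwise = subst (_≡ sumBelow p approximation mod (P * P))
      (sym (*-distribˡ-sum {p} (3 * a) (λ i → g P (residue (toℕ i)) * g P (toℕ i))))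
      (sum-≡mod {p} (λ i → 3 * a * (g P (residue (toℕ i)) * g P (toℕ i))) (approximation ∘ toℕ)
        (λ i → term-congruence a N P (carry (toℕ i)) (residue (toℕ i)) (toℕ i) (solve-for (division (toℕ i)))))
    closed-form : α * (P * (P - 1) * (2 * P - 1)) + β * (P * (P - 1)) + γ * P + ε
                    ≡ P * (a * a + (1 + 6 * (N * N))) mod (P * P)
    closed-form = divides ((1 + a * a) * (2 * P - 3) + 6 * a * N - 6 * N - 6 * a * P + 6 * a) (identity a N P)
      where
      identity : ∀ a N P →
        (1 + a * a) * (P * (P - 1) * (2 * P - 1)) + (6 * a * N - 6 * N - 6 * a * P) * (P * (P - 1))
          + 6 * (N * N) * P + 6 * P * N * (a - 1) - P * (a * a + (1 + 6 * (N * N)))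
        ≡ ((1 + a * a) * (2 * P - 3) + 6 * a * N - 6 * N - 6 * a * P + 6 * a) * (P * P)
      identity = solve-∀

corollary2 : (p : ℕ) → (pr : Prime p) → (n : ℕ) → (a₁ a₂ : ℤ)
    → ¬ ((+ p) ∣ a₁) → ¬ ((+ p) ∣ a₂)
    → r n a₁ p {{prime⇒nonZero pr}} ≡ r n a₂ p {{prime⇒nonZero pr}}
    → ((+ p) ∣ (a₁ - a₂)) ⊎ ((+ p) ∣ (a₁ * a₂ - (+ 1 + + 6 * (+ n * + n))))
corollary2 zero      pr = ⊥-elim (ℕ.NonZero.nonZero (prime⇒nonZero pr))
corollary2 (suc p′) pr n a₁ a₂ p∤a₁ p∤a₂ r₁≡r₂ =
  prime-∣-* pr (a₁ - a₂) (a₁ * a₂ - c) (Signed.∣⇒∣ᵤ (eliminate {P} {R₁.G} {c} {a₁} {a₂} key₁ key₂))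
  where
  P c : ℤ
  P = + suc p′
  c = 1 + 6 * (+ n * + n)
  module R₁ = Residues p′ a₁ n
  module R₂ = Residues p′ a₂ n
  G₁≡G₂ : R₁.G ≡ R₂.G
  G₁≡G₂ = numerator-injective _ (ℚᵘP.≃-trans (ℚᵘP.≃-sym R₁.r-fraction)
                                (ℚᵘP.≃-trans (ℚP.toℚᵘ-cong r₁≡r₂) R₂.r-fraction))
  key₁ : 3 * a₁ * R₁.G ≡ P * (a₁ * a₁ + c) mod (P * P)
  key₁ = R₁.key-congruence pr p∤a₁
  key₂ : 3 * a₂ * R₁.G ≡ P * (a₂ * a₂ + c) mod (P * P)
  key₂ = subst (λ G → 3 * a₂ * G ≡ P * (a₂ * a₂ + c) mod (P * P)) (sym G₁≡G₂) (R₂.key-congruence pr p∤a₂)
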